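{- The class of cycles (graphs isomorphic to $C_m$ for some $m\ge3$) has no $2$ adaptive hom algorithm.
   Context: Graphs are finite, simple, undirected, with non-empty vertex set; classes are closed under isomorphism; $\textsc{Graph}$ is the class of all graphs; $C_m$ is the cycle on $m$ vertices. $\hom(F,G)$ is the number of homomorphisms from $F$ to $G$. For $k\ge1$, a $k$ adaptive hom algorithm for a class $\mathcal C$ consists of a graph $F$, a function $N:\bigcup_{i\in[k-1]}\mathbb N^i\to\textsc{Graph}$, and a set $X\subseteq\mathbb N^k$ such that for all graphs $G$: $G\in\mathcal C\iff(n_1,\dots,n_k)\in X$, where $n_1:=\hom(F,G)$ and $n_{j+1}:=\hom(N(n_1,\dots,n_j),G)$ for $j\in[k-1]$. -}

module Defs where

open import Data.Nat using (ℕ; zero; suc; _≤_; _%_; _≡ᵇ_)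
open import Data.Nat.Properties using ()
open import Data.Bool using (Bool; true; false; _∧_; _∨_; if_then_else_)
open import Data.Fin using (Fin; toℕ)
open import Data.List using (List; []; _∷_; map; concatMap; length; filterᵇ; allFin)
open import Data.Vec using (Vec; []; _∷_; lookup)
open import Data.Product using (Σ; _×_; _,_)
open import Function.Bundles using (_↔_; Inverse)
open import Relation.Binary.PropositionalEquality using (_≡_)

record Graph : Set where
  field
    order    : ℕ
    nonEmpty : 1 ≤ order
    adj      : Fin order → Fin order → Bool
    sym      : ∀ i j → adj i j ≡ adj j i
    irrefl   : ∀ i → adj i i ≡ false
open Graph public

allMaps : (a b : ℕ) → List (Vec (Fin b) a)
allMaps zero    b = [] ∷ []
allMaps (suc a) b = concatMap (λ v → map (λ x → x ∷ v) (allFin b)) (allMaps a b)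

allᵇ : {A : Set} → (A → Bool) → List A → Bool
allᵇ p []       = true
allᵇ p (x ∷ xs) = p x ∧ allᵇ p xs

isHom : (F G : Graph) → Vec (Fin (order G)) (order F) → Bool
isHom F G f =
  allᵇ (λ i → allᵇ (λ j → if adj F i j then adj G (lookup f i) (lookup f j) else true)
                 (allFin (order F)))
      (allFin (order F))

hom : Graph → Graph → ℕ
hom F G = length (filterᵇ (isHom F G) (allMaps (order F) (order G)))

cycleAdj : (m : ℕ) → Fin m → Fin m → Bool
cycleAdj zero    i j = false
cycleAdj (suc k) i j =
  ((suc (toℕ i) % suc k) ≡ᵇ toℕ j) ∨ ((suc (toℕ j) % suc k) ≡ᵇ toℕ i)

IsoToCycle : ℕ → Graph → Set
IsoToCycle m G =
  Σ (Fin m ↔ Fin (order G)) λ σ →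
    ∀ i j → adj G (Inverse.to σ i) (Inverse.to σ j) ≡ cycleAdj m i j

IsCycle : Graph → Set
IsCycle G = Σ ℕ λ m → (3 ≤ m) × IsoToCycle m G

-- A 2 adaptive hom algorithm for a class 𝒞 (given as a predicate on graphs):
-- a graph F, a function N : ℕ → Graph (N restricted to ℕ^1), and X ⊆ ℕ²,
-- such that G ∈ 𝒞 ⇔ (hom(F,G), hom(N(hom(F,G)),G)) ∈ X for all graphs G.
record TwoAdaptiveHomAlgorithm (𝒞 : Graph → Set) : Set₁ where
  field
    F : Graph
    N : ℕ → Graph
    X : ℕ × ℕ → Set
    correct : ∀ G → (𝒞 G → X (hom F G , hom (N (hom F G)) G))
                  × (X (hom F G , hom (N (hom F G)) G) → 𝒞 G)

-- Let F be the first query graph and q = 2·|V(F)| + 3, an odd number larger than |V(F)|.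
-- Homomorphisms into a cycle longer than |V(F)| miss a vertex, so they can be cut open and
-- counted blockwise: hom(F, C_{mk}) = hom(F, C_m) · hom(F, k·K₁°) = hom(F, k·C_m) whenever
-- |V(F)| < m, where k·K₁° consists of k looped vertices.  Hence F gives the same answer on
-- the cycle C_{2q²} and on the two non-cycles 2·C_{q²} and q·C_{2q}.  For odd m the Chinese
-- remainder theorem gives C_{2m} ≅ C_m × K₂, so hom(Q, C_{2m}) = hom(Q, C_m) · hom(Q, K₂).
-- If the second query graph Q is not bipartite, it therefore has no homomorphism into C_{2q²}
-- nor into q·C_{2q}; if it is bipartite, hom(Q, K₂) = hom(Q, 2·K₁°) and Q gives the same
-- answer on C_{2q²} and 2·C_{q²}.  Either way the algorithm answers identically on a cycle
-- and on a non-cycle.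

module Submission where

open import Data.Bool using (Bool; true; false; T; _∧_; if_then_else_)
open import Data.Bool.Properties using (T?; T-∧; T-∨; ∨-comm; ∧-zeroʳ)
open import Data.Empty using (⊥)
open import Data.Fin using (Fin; zero; suc; toℕ; fromℕ<; inject₁; quotient; remainder; combine; _≟_)
open import Data.Fin.Induction using (<-weakInduction)
open import Data.Fin.Properties
  using (¬Fin0; toℕ<n; toℕ-fromℕ<; toℕ-injective; toℕ-inject₁; remQuot-combine; combine-remQuot;
         any?; all?; ¬∀⟶∃¬; pigeonhole)
import Data.Fin.Properties as Fin
open import Data.List using (List; []; _∷_; _++_; length; filterᵇ; cartesianProduct; allFin)
import Data.List as List
open import Data.List.Properties using (length-++; length-++-sucʳ; filter-++; filter-accept; filter-reject)
open import Data.List.Membership.Propositional using (_∈_)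
open import Data.List.Membership.Propositional.Properties
  using (∈-∃++; ∈-++⁻; ∈-++⁺ˡ; ∈-++⁺ʳ; ∈-filter⁺; ∈-filter⁻; ∈-map⁻; ∈-map⁺; ∈-concatMap⁺;
         ∈-allFin; ∈-cartesianProduct⁺)
open import Data.List.Relation.Unary.All using (All; []; _∷_)
import Data.List.Relation.Unary.All as All
import Data.List.Relation.Unary.All.Properties as All
import Data.List.Relation.Unary.AllPairs as AllPairs
import Data.List.Relation.Unary.AllPairs.Properties as AllPairs
open import Data.List.Relation.Unary.Any using (here; there)
import Data.List.Relation.Unary.Any as Any
open import Data.List.Relation.Unary.Unique.Propositional using (Unique; []; _∷_)
import Data.List.Relation.Unary.Unique.Propositional.Properties as Unique
open import Data.Nat using (ℕ; zero; suc; _+_; _*_; _∸_; _≤_; _<_; z≤n; s≤s; _≡ᵇ_; NonZero; >-nonZero⁻¹)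
open import Data.Nat.DivMod
open import Data.Nat.Divisibility using (_∣_; ∣-refl; m∣m*n; n∣m*n)
open import Data.Nat.Properties hiding (_≟_)
import Data.Nat.Properties as ℕ
open import Data.Product using (Σ; ∃; ∃₂; _×_; _,_; proj₁; proj₂)
open import Data.Sum using (_⊎_; inj₁; inj₂; [_,_]′; reduce; swap)
import Data.Sum as Sum
open import Data.Vec using (Vec; []; _∷_; lookup; map; zipWith)
open import Data.Vec.Properties
  using (∷-injective; lookup-map; lookup-zipWith; map-∘; map-cong; map-id; tabulate∘lookup; tabulate-cong)
open import Function using (_∘_; _∘′_; id; _on_)
open import Function.Bundles using (_⇔_; mk⇔; Equivalence; Inverse; _↔_; mk↔ₛ′)
open import Function.Construct.Identity using (↔-id)
open import Relation.Nullary using (¬_; contradiction; yes; no; ¬?)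
open import Relation.Nullary.Decidable using (⌊_⌋; toWitness; fromWitness; decidable-stable)
open import Relation.Unary using (Pred; _⟨×⟩_)
open import Relation.Binary.PropositionalEquality

open import Defs hiding (sym)

private
  variable
    A B : Set
    a b n x y : ℕ

-- Counting

count : (A → Bool) → List A → ℕ
count p xs = length (filterᵇ p xs)

IsEnumeration : List A → Set
IsEnumeration xs = Unique xs × (∀ x → x ∈ xs)

record Correspondence {A B : Set} (P : A → Set) (Q : B → Set) : Set where
  field
    to        : A → B
    from      : B → A
    to-resp   : ∀ {a} → P a → Q (to a)
    from-resp : ∀ {b} → Q b → P (from b)
    from∘to   : ∀ {a} → P a → from (to a) ≡ a
    to∘from   : ∀ {b} → Q b → to (from b) ≡ b

  flip : Correspondence Q P
  flip = record
    { to = from ; from = to ; to-resp = from-resp ; from-resp = to-resp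
    ; from∘to = to∘from ; to∘from = from∘to }

Correspondence-resp-⇔ : {P P′ : A → Set} {Q Q′ : B → Set} →
                        (∀ a → P a ⇔ P′ a) → (∀ b → Q b ⇔ Q′ b) →
                        Correspondence P′ Q′ → Correspondence P Q
Correspondence-resp-⇔ P⇔P′ Q⇔Q′ c = record
  { to        = to
  ; from      = from
  ; to-resp   = λ {a} → Equivalence.from (Q⇔Q′ (to a)) ∘ to-resp ∘ Equivalence.to (P⇔P′ a)
  ; from-resp = λ {b} → Equivalence.from (P⇔P′ (from b)) ∘ from-resp ∘ Equivalence.to (Q⇔Q′ b)
  ; from∘to   = λ {a} → from∘to ∘ Equivalence.to (P⇔P′ a)
  ; to∘from   = λ {b} → to∘from ∘ Equivalence.to (Q⇔Q′ b)
  }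
  where open Correspondence c

length-≤-injectionOn : {xs : List A} {ys : List B} (f : A → B) → Unique xs →
                       (∀ {x} → x ∈ xs → f x ∈ ys) →
                       (∀ {x y} → x ∈ xs → y ∈ xs → f x ≡ f y → x ≡ y) →
                       length xs ≤ length ys
length-≤-injectionOn {xs = []}     f _           _    _     = z≤n
length-≤-injectionOn {xs = x ∷ xs} f (x∉xs ∷ xs!) f∈ys f-inj
  with ys₁ , ys₂ , refl ← ∈-∃++ (f∈ys (here refl)) =
  subst (length (x ∷ xs) ≤_) (sym (length-++-sucʳ ys₁ (f x) ys₂))
    (s≤s (length-≤-injectionOn f xs! f∈ys₁++ys₂ (λ y∈ z∈ → f-inj (there y∈) (there z∈))))
  where
  f∈ys₁++ys₂ : ∀ {y} → y ∈ xs → f y ∈ ys₁ ++ ys₂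
  f∈ys₁++ys₂ {y} y∈xs with ∈-++⁻ ys₁ (f∈ys (there y∈xs))
  ... | inj₁ fy∈ys₁         = ∈-++⁺ˡ fy∈ys₁
  ... | inj₂ (here fy≡fx)   = contradiction (f-inj (here refl) (there y∈xs) (sym fy≡fx)) (All.lookup x∉xs y∈xs)
  ... | inj₂ (there fy∈ys₂) = ∈-++⁺ʳ ys₁ fy∈ys₂

count-mono : {p : A → Bool} {q : B → Bool} {xs : List A} {ys : List B} →
             Unique xs → (∀ y → y ∈ ys) → Correspondence (T ∘ p) (T ∘ q) →
             count p xs ≤ count q ys
count-mono {p = p} {q} {xs} {ys} xs! ys-complete c =
  length-≤-injectionOn to (Unique.filter⁺ (T? ∘ p) xs!) to∈ to-injective
  where
  open Correspondence c
  p-holds : ∀ {a} → a ∈ filterᵇ p xs → T (p a)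
  p-holds a∈ = proj₂ (∈-filter⁻ (T? ∘ p) {xs = xs} a∈)
  to∈ : ∀ {a} → a ∈ filterᵇ p xs → to a ∈ filterᵇ q ys
  to∈ a∈ = ∈-filter⁺ (T? ∘ q) (ys-complete _) (to-resp (p-holds a∈))
  to-injective : ∀ {a a′} → a ∈ filterᵇ p xs → a′ ∈ filterᵇ p xs → to a ≡ to a′ → a ≡ a′
  to-injective a∈ a′∈ eq = trans (sym (from∘to (p-holds a∈))) (trans (cong from eq) (from∘to (p-holds a′∈)))

count-correspondence : {p : A → Bool} {q : B → Bool} {xs : List A} {ys : List B} →
                       IsEnumeration xs → IsEnumeration ys → Correspondence (T ∘ p) (T ∘ q) →
                       count p xs ≡ count q ys
count-correspondence (xs! , xs-complete) (ys! , ys-complete) c =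
  ≤-antisym (count-mono xs! ys-complete c) (count-mono ys! xs-complete (Correspondence.flip c))

count-++ : (p : A → Bool) (xs ys : List A) → count p (xs ++ ys) ≡ count p xs + count p ys
count-++ p xs ys = trans (cong length (filter-++ (T? ∘ p) xs ys)) (length-++ (filterᵇ p xs))

count-map : (p : B → Bool) (f : A → B) (xs : List A) → count p (List.map f xs) ≡ count (p ∘ f) xs
count-map p f []       = refl
count-map p f (x ∷ xs) with p (f x)
... | true  = cong suc (count-map p f xs)
... | false = count-map p f xs

count-false : (xs : List A) → count (λ _ → false) xs ≡ 0
count-false []       = refl
count-false (_ ∷ xs) = count-false xs

count≢0⇒∃ : (p : A → Bool) (xs : List A) → count p xs ≢ 0 → Σ A (T ∘ p)
count≢0⇒∃ p []       count≢0 = contradiction refl count≢0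
count≢0⇒∃ p (x ∷ xs) count≢0 with p x in px
... | true  = x , subst T (sym px) _
... | false = count≢0⇒∃ p xs count≢0

_∧×_ : (A → Bool) → (B → Bool) → A × B → Bool
(p ∧× q) (a , b) = p a ∧ q b

count-cartesianProduct : (p : A → Bool) (q : B → Bool) (xs : List A) (ys : List B) →
                         count (p ∧× q) (cartesianProduct xs ys) ≡ count p xs * count q ys
count-cartesianProduct p q []       ys = refl
count-cartesianProduct p q (x ∷ xs) ys = begin
  count (p ∧× q) (List.map (x ,_) ys ++ cartesianProduct xs ys)
    ≡⟨ count-++ (p ∧× q) (List.map (x ,_) ys) _ ⟩
  count (p ∧× q) (List.map (x ,_) ys) + count (p ∧× q) (cartesianProduct xs ys)
    ≡⟨ cong₂ _+_ (count-map (p ∧× q) (x ,_) ys) (count-cartesianProduct p q xs ys) ⟩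
  count (λ y → p x ∧ q y) ys + count p xs * count q ys
    ≡⟨ row (p x) refl ⟩
  count p (x ∷ xs) * count q ys ∎
  where
  open ≡-Reasoning
  row : ∀ c → p x ≡ c → count (λ y → c ∧ q y) ys + count p xs * count q ys ≡ count p (x ∷ xs) * count q ys
  row true  px = cong (_* count q ys) (sym (cong length (filter-accept (T? ∘ p) (subst T (sym px) _))))
  row false px = cong₂ _+_ (count-false ys)
                   (cong (_* count q ys) (sym (cong length (filter-reject (T? ∘ p) (subst T px)))))

cartesianProduct-isEnumeration : {xs : List A} {ys : List B} → IsEnumeration xs → IsEnumeration ys →
                                 IsEnumeration (cartesianProduct xs ys)
cartesianProduct-isEnumeration (xs! , xs-complete) (ys! , ys-complete) =
  Unique.cartesianProduct⁺ xs! ys! , λ (x , y) → ∈-cartesianProduct⁺ (xs-complete x) (ys-complete y)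

allMaps-isEnumeration : ∀ a b → IsEnumeration (allMaps a b)
allMaps-isEnumeration a b = allMaps-unique a , allMaps-complete a
  where
  extend : ∀ {a} → Vec (Fin b) a → List (Vec (Fin b) (suc a))
  extend v = List.map (_∷ v) (allFin b)
  allMaps-complete : ∀ a (v : Vec (Fin b) a) → v ∈ allMaps a b
  allMaps-complete zero    []      = here refl
  allMaps-complete (suc a) (x ∷ v) =
    ∈-concatMap⁺ extend (Any.map (λ { refl → ∈-map⁺ (_∷ v) (∈-allFin x) }) (allMaps-complete a v))
  allMaps-unique : ∀ a → Unique (allMaps a b)
  allMaps-unique zero    = [] ∷ []
  allMaps-unique (suc a) =
    Unique.concat⁺ (All.map⁺ (All.universal (λ _ → Unique.map⁺ (proj₁ ∘ ∷-injective) (Unique.allFin⁺ b)) _))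
      (AllPairs.map⁺ (AllPairs.map disjoint (allMaps-unique a)))
    where
    disjoint : ∀ {v w : Vec (Fin b) a} → v ≢ w → ∀ {u} → u ∈ extend v × u ∈ extend w → ⊥
    disjoint v≢w (u∈ , u∈′) with ∈-map⁻ (_∷ _) u∈ | ∈-map⁻ (_∷ _) u∈′
    ... | _ , _ , refl | _ , _ , eq = v≢w (proj₂ (∷-injective eq))

-- Homomorphisms into Boolean relations

BoolRel : ℕ → Set
BoolRel b = Fin b → Fin b → Bool

-- The test of Defs.isHom for an arbitrary target relation, so that hom F G is homTo F (adj G)
-- by definition.
isHomTo : (F : Graph) → BoolRel b → Vec (Fin b) (order F) → Bool
isHomTo F R f =
  allᵇ (λ i → allᵇ (λ j → if adj F i j then R (lookup f i) (lookup f j) else true)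
                 (allFin (order F)))
      (allFin (order F))

homTo : (F : Graph) → BoolRel b → ℕ
homTo F R = count (isHomTo F R) (allMaps (order F) _)

IsHomTo : (F : Graph) → BoolRel b → Pred (Vec (Fin b) (order F)) _
IsHomTo F R f = ∀ i j → T (adj F i j) → T (R (lookup f i) (lookup f j))

T-allᵇ : (p : A → Bool) (xs : List A) → T (allᵇ p xs) ⇔ All (T ∘ p) xs
T-allᵇ p []       = mk⇔ (λ _ → []) (λ _ → _)
T-allᵇ p (x ∷ xs) = mk⇔
  (λ t → let (px , pxs) = Equivalence.to T-∧ t in px ∷ Equivalence.to (T-allᵇ p xs) pxs)
  (λ { (px ∷ pxs) → Equivalence.from T-∧ (px , Equivalence.from (T-allᵇ p xs) pxs) })

T-allᵇ-allFin : (p : Fin a → Bool) → T (allᵇ p (allFin a)) ⇔ (∀ i → T (p i))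
T-allᵇ-allFin p = mk⇔
  (λ t i → All.lookup (Equivalence.to (T-allᵇ p (allFin _)) t) (∈-allFin i))
  (λ h → Equivalence.from (T-allᵇ p (allFin _)) (All.tabulate (λ {i} _ → h i)))

T-if-then-true : (c d : Bool) → T (if c then d else true) ⇔ (T c → T d)
T-if-then-true true  d = mk⇔ (λ t _ → t) (λ h → h _)
T-if-then-true false d = mk⇔ (λ _ ()) (λ _ → _)

T-isHomTo : (F : Graph) (R : BoolRel b) (f : Vec (Fin b) (order F)) → T (isHomTo F R f) ⇔ IsHomTo F R f
T-isHomTo F R f = mk⇔
  (λ t i j → Equivalence.to (T-if-then-true (adj F i j) _)
               (Equivalence.to (T-allᵇ-allFin _) (Equivalence.to (T-allᵇ-allFin _) t i) j))
  (λ h → Equivalence.from (T-allᵇ-allFin _) λ i → Equivalence.from (T-allᵇ-allFin _) λ j →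
           Equivalence.from (T-if-then-true (adj F i j) _) (h i j))

T-injective : ∀ {c d} → T c ⇔ T d → c ≡ d
T-injective {false} {false} _   = refl
T-injective {false} {true}  c⇔d = contradiction (Equivalence.from c⇔d _) id
T-injective {true}  {false} c⇔d = contradiction (Equivalence.to c⇔d _) id
T-injective {true}  {true}  _   = refl

¬T⇒≡false : ∀ {c} → ¬ T c → c ≡ false
¬T⇒≡false {true}  ¬t = contradiction _ ¬t
¬T⇒≡false {false} _  = refl

lookup-ext : {u v : Vec A n} → (∀ i → lookup u i ≡ lookup v i) → u ≡ v
lookup-ext {u = u} {v} eq = trans (sym (tabulate∘lookup u)) (trans (tabulate-cong eq) (tabulate∘lookup v))

IsHomTo-map : (F : Graph) (g : Fin a → Fin b) (R : BoolRel b) (f : Vec (Fin a) (order F)) →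
              IsHomTo F R (map g f) ⇔ IsHomTo F (R on g) f
IsHomTo-map F g R f = mk⇔
  (λ h i j e → subst T (cong₂ R (lookup-map i g f) (lookup-map j g f)) (h i j e))
  (λ h i j e → subst T (sym (cong₂ R (lookup-map i g f) (lookup-map j g f))) (h i j e))

module _ (F : Graph) where

  homTo-correspondence : (R : BoolRel a) (S : BoolRel b) →
                         Correspondence (IsHomTo F R) (IsHomTo F S) → homTo F R ≡ homTo F S
  homTo-correspondence R S c =
    count-correspondence (allMaps-isEnumeration _ _) (allMaps-isEnumeration _ _)
      (Correspondence-resp-⇔ (T-isHomTo F R) (T-isHomTo F S) c)

  homTo-factor : (R : BoolRel (a * b)) (R₁ : BoolRel a) (R₂ : BoolRel b) →
                 Correspondence (IsHomTo F R) (IsHomTo F R₁ ⟨×⟩ IsHomTo F R₂) →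
                 homTo F R ≡ homTo F R₁ * homTo F R₂
  homTo-factor R R₁ R₂ c = begin
    homTo F R
      ≡⟨ count-correspondence (allMaps-isEnumeration _ _)
           (cartesianProduct-isEnumeration (allMaps-isEnumeration _ _) (allMaps-isEnumeration _ _))
           (Correspondence-resp-⇔ (T-isHomTo F R) T-pair c) ⟩
    count (isHomTo F R₁ ∧× isHomTo F R₂) (cartesianProduct (allMaps (order F) _) (allMaps (order F) _))
      ≡⟨ count-cartesianProduct (isHomTo F R₁) (isHomTo F R₂) (allMaps (order F) _) (allMaps (order F) _) ⟩
    homTo F R₁ * homTo F R₂ ∎
    where
    open ≡-Reasoning
    T-pair : ∀ uv → T ((isHomTo F R₁ ∧× isHomTo F R₂) uv) ⇔ (IsHomTo F R₁ ⟨×⟩ IsHomTo F R₂) uv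
    T-pair (u , v) = mk⇔
      (λ t → let (tu , tv) = Equivalence.to T-∧ t in
             Equivalence.to (T-isHomTo F R₁ u) tu , Equivalence.to (T-isHomTo F R₂ v) tv)
      (λ (hu , hv) → Equivalence.from T-∧
                       (Equivalence.from (T-isHomTo F R₁ u) hu , Equivalence.from (T-isHomTo F R₂ v) hv))

  homTo-↔ : (R : BoolRel a) (S : BoolRel b) (σ : Fin a ↔ Fin b) →
            (∀ x y → S (Inverse.to σ x) (Inverse.to σ y) ≡ R x y) → homTo F R ≡ homTo F S
  homTo-↔ R S σ σ-adj = homTo-correspondence R S (record
    { to        = map to
    ; from      = map from
    ; to-resp   = λ {f} f-hom → Equivalence.from (IsHomTo-map F to S f)
        λ i j e → subst T (sym (σ-adj (lookup f i) (lookup f j))) (f-hom i j e)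
    ; from-resp = λ {g} g-hom → Equivalence.from (IsHomTo-map F from R g)
        λ i j e → subst T (trans (sym (cong₂ S (strictlyInverseˡ _) (strictlyInverseˡ _))) (σ-adj _ _)) (g-hom i j e)
    ; from∘to   = λ {f} _ → map-inverse from to strictlyInverseʳ f
    ; to∘from   = λ {g} _ → map-inverse to from strictlyInverseˡ g
    })
    where
    open Inverse σ
    map-inverse : (g : A → B) (h : B → A) → (∀ x → g (h x) ≡ x) →
                  (v : Vec B (order F)) → map g (map h v) ≡ v
    map-inverse g h gh v = trans (sym (map-∘ g h v)) (trans (map-cong gh v) (map-id v))

-- Cycles

Step : (n : ℕ) .{{_ : NonZero n}} → ℕ → ℕ → Set
Step n x y = suc x % n ≡ y

T-cycleAdj : .{{_ : NonZero n}} (i j : Fin n) →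
             T (cycleAdj n i j) ⇔ (Step n (toℕ i) (toℕ j) ⊎ Step n (toℕ j) (toℕ i))
T-cycleAdj {suc n} i j = mk⇔
  (Sum.map (≡ᵇ⇒≡ _ _) (≡ᵇ⇒≡ _ _) ∘ Equivalence.to T-∨)
  (Equivalence.from T-∨ ∘ Sum.map (≡⇒≡ᵇ _ _) (≡⇒≡ᵇ _ _))

T-cycleAdj-mod : ∀ d .{{_ : NonZero d}} x y →
                 T (cycleAdj d (x mod d) (y mod d)) ⇔ (Step d (x % d) (y % d) ⊎ Step d (y % d) (x % d))
T-cycleAdj-mod d x y = subst₂ (λ u v → T (cycleAdj d (x mod d) (y mod d)) ⇔ (Step d u v ⊎ Step d v u))
  (toℕ-fromℕ< (m%n<n x d)) (toℕ-fromℕ< (m%n<n y d)) (T-cycleAdj (x mod d) (y mod d))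

cycleAdj-sym : (i j : Fin n) → cycleAdj n i j ≡ cycleAdj n j i
cycleAdj-sym {suc n} i j = ∨-comm (suc (toℕ i) % suc n ≡ᵇ toℕ j) _

Step-irrefl : .{{_ : NonZero n}} → 2 ≤ n → x < n → ¬ Step n x x
Step-irrefl {n} {x} 2≤n x<n step with m≤n⇒m<n∨m≡n x<n
... | inj₁ 1+x<n = 1+n≢n (trans (sym (m<n⇒m%n≡m 1+x<n)) step)
... | inj₂ refl with refl ← trans (sym (n%n≡0 n)) step with s≤s () ← 2≤n

cycleAdj-irrefl : 2 ≤ n → (i : Fin n) → cycleAdj n i i ≡ false
cycleAdj-irrefl {suc n} 2≤n i =
  ¬T⇒≡false (Step-irrefl 2≤n (toℕ<n i) ∘ reduce ∘ Equivalence.to (T-cycleAdj i i))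

%-suc : ∀ x d .{{_ : NonZero d}} → suc (x % d) % d ≡ suc x % d
%-suc x d = begin
  suc (x % d) % d         ≡⟨ %-distribˡ-+ 1 (x % d) d ⟩
  (1 % d + x % d % d) % d ≡⟨ cong (λ z → (1 % d + z) % d) (m%n%n≡m%n x d) ⟩
  (1 % d + x % d) % d     ≡⟨ %-distribˡ-+ 1 x d ⟨
  suc x % d               ∎
  where open ≡-Reasoning

Step-mod : ∀ {d} .{{_ : NonZero d}} .{{_ : NonZero n}} → d ∣ n → Step n x y → Step d (x % d) (y % d)
Step-mod {n} {x} {y} {d} d∣n step = begin
  suc (x % d) % d ≡⟨ %-suc x d ⟩
  suc x % d       ≡⟨ m∣n⇒o%n%m≡o%m d n (suc x) d∣n ⟨
  suc x % n % d   ≡⟨ cong (_% d) step ⟩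
  y % d           ∎
  where open ≡-Reasoning

IsHomTo-residues : (F : Graph) {n : ℕ} (d : ℕ) .{{_ : NonZero n}} .{{_ : NonZero d}} → d ∣ n →
                   (f : Vec (Fin n) (order F)) → IsHomTo F (cycleAdj n) f →
                   IsHomTo F (cycleAdj d) (map (λ x → toℕ x mod d) f)
IsHomTo-residues F d d∣n f f-hom = Equivalence.from (IsHomTo-map F (λ x → toℕ x mod d) (cycleAdj d) f) λ i j e →
  Equivalence.from (T-cycleAdj-mod d (toℕ (lookup f i)) (toℕ (lookup f j)))
    (Sum.map (Step-mod d∣n) (Step-mod d∣n) (Equivalence.to (T-cycleAdj (lookup f i) (lookup f j)) (f-hom i j e)))

cycleGraph : (n : ℕ) → 2 ≤ n → Graph
cycleGraph n 2≤n = record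
  { order    = n
  ; nonEmpty = ≤-trans (s≤s z≤n) 2≤n
  ; adj      = cycleAdj n
  ; sym      = cycleAdj-sym
  ; irrefl   = cycleAdj-irrefl 2≤n
  }

cycleGraph-isCycle : (2≤n : 2 ≤ n) → 3 ≤ n → IsCycle (cycleGraph n 2≤n)
cycleGraph-isCycle {n} _ 3≤n = n , 3≤n , ↔-id (Fin n) , λ _ _ → refl

cycleAdj-connected : (h : Fin (suc n) → A) → (∀ i j → T (cycleAdj (suc n) i j) → h i ≡ h j) →
                     ∀ i → h i ≡ h zero
cycleAdj-connected {n} h h-const = <-weakInduction (λ i → h i ≡ h zero) refl
  λ j hj≡h0 → trans (sym (h-const (inject₁ j) (suc j) (edge j))) hj≡h0
  where
  edge : ∀ j → T (cycleAdj (suc n) (inject₁ j) (suc j))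
  edge j = Equivalence.from (T-cycleAdj (inject₁ j) (suc j))
             (inj₁ (trans (cong (λ x → suc x % suc n) (toℕ-inject₁ j)) (m<n⇒m%n≡m (s≤s (toℕ<n j)))))

IsoToCycle-connected : ∀ {M} (G : Graph) → IsoToCycle M G →
                       (g : Fin (order G) → A) → (∀ x y → T (adj G x y) → g x ≡ g y) →
                       ∀ x y → g x ≡ g y
IsoToCycle-connected {M = zero}  G (σ , _)     g g-const x y = contradiction (Inverse.from σ x) ¬Fin0
IsoToCycle-connected {M = suc M} G (σ , σ-adj) g g-const x y = begin
  g x                  ≡⟨ cong g (Inverse.strictlyInverseˡ σ x) ⟨
  h (Inverse.from σ x) ≡⟨ h-const (Inverse.from σ x) ⟩
  h zero               ≡⟨ h-const (Inverse.from σ y) ⟨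
  h (Inverse.from σ y) ≡⟨ cong g (Inverse.strictlyInverseˡ σ y) ⟩
  g y                  ∎
  where
  open ≡-Reasoning
  h : Fin (suc M) → _
  h = g ∘ Inverse.to σ
  h-const : ∀ i → h i ≡ h zero
  h-const = cycleAdj-connected h λ i j e → g-const _ _ (subst T (sym (σ-adj i j)) e)

-- Tensor products and disjoint copies of cycles

-- n looped vertices: homomorphisms into it are the maps that are constant on components.
diagonal : (n : ℕ) → BoolRel n
diagonal n i j = ⌊ i ≟ j ⌋

T-diagonal : (i j : Fin n) → T (diagonal n i j) ⇔ i ≡ j
T-diagonal i j = mk⇔ toWitness fromWitness

diagonal-sym : (i j : Fin n) → diagonal n i j ≡ diagonal n j i
diagonal-sym i j with i ≟ j | j ≟ i
... | yes _   | yes _   = refl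
... | yes i≡j | no j≢i  = contradiction (sym i≡j) j≢i
... | no i≢j  | yes j≡i = contradiction (sym j≡i) i≢j
... | no _    | no _    = refl

infixr 7 _⊗_

-- The categorical product of relations, on Fin (a * b) ≅ Fin a × Fin b via combine/remQuot.
-- In particular diagonal k ⊗ cycleAdj m is k disjoint copies of C_m.
_⊗_ : BoolRel a → BoolRel b → BoolRel (a * b)
(_⊗_ {a} {b} R S) x y = R (quotient b x) (quotient b y) ∧ S (remainder {a} b x) (remainder {a} b y)

quotient-combine : (x : Fin a) (y : Fin b) → quotient b (combine x y) ≡ x
quotient-combine x y = cong proj₁ (remQuot-combine x y)

remainder-combine : (x : Fin a) (y : Fin b) → remainder {a} b (combine x y) ≡ y
remainder-combine x y = cong proj₂ (remQuot-combine x y)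

⊗-combine : (R : BoolRel a) (S : BoolRel b) (x : Fin a) (y : Fin b) (x′ : Fin a) (y′ : Fin b) →
            (R ⊗ S) (combine x y) (combine x′ y′) ≡ R x x′ ∧ S y y′
⊗-combine R S x y x′ y′ = cong₂ _∧_ (cong₂ R (quotient-combine x y) (quotient-combine x′ y′))
                                    (cong₂ S (remainder-combine x y) (remainder-combine x′ y′))

⊗-sym : (R : BoolRel a) (S : BoolRel b) → (∀ x y → R x y ≡ R y x) → (∀ x y → S x y ≡ S y x) →
        ∀ x y → (R ⊗ S) x y ≡ (R ⊗ S) y x
⊗-sym {a} {b} R S R-sym S-sym x y =
  cong₂ _∧_ (R-sym (quotient b x) (quotient b y)) (S-sym (remainder {a} b x) (remainder {a} b y))

⊗-irreflexiveʳ : (R : BoolRel a) (S : BoolRel b) → (∀ y → S y y ≡ false) → ∀ x → (R ⊗ S) x x ≡ false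
⊗-irreflexiveʳ {a} {b} R S S-irrefl x =
  trans (cong (R (quotient b x) (quotient b x) ∧_) (S-irrefl (remainder {a} b x))) (∧-zeroʳ _)

homTo-⊗ : (F : Graph) (R : BoolRel a) (S : BoolRel b) → homTo F (R ⊗ S) ≡ homTo F R * homTo F S
homTo-⊗ {a} {b} F R S = homTo-factor F (_⊗_ {a} {b} R S) R S (record
  { to        = λ f → map quo f , map rem f
  ; from      = λ (u , v) → zipWith combine u v
  ; to-resp   = λ {f} h →
      Equivalence.from (IsHomTo-map F quo R f) (λ i j e → proj₁ (Equivalence.to T-∧ (h i j e))) ,
      Equivalence.from (IsHomTo-map F rem S f) (λ i j e → proj₂ (Equivalence.to T-∧ (h i j e)))
  ; from-resp = λ {(u , v)} (hu , hv) i j e →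
      subst T (sym (trans (cong₂ (_⊗_ {a} {b} R S) (lookup-zipWith combine i u v) (lookup-zipWith combine j u v))
                          (⊗-combine R S (lookup u i) (lookup v i) (lookup u j) (lookup v j))))
        (Equivalence.from T-∧ (hu i j e , hv i j e))
  ; from∘to   = λ {f} _ → lookup-ext λ i →
      trans (lookup-zipWith combine i (map quo f) (map rem f))
        (trans (cong₂ combine (lookup-map i quo f) (lookup-map i rem f)) (combine-remQuot {a} b (lookup f i)))
  ; to∘from   = λ {(u , v)} _ → cong₂ _,_
      (lookup-ext λ i → trans (lookup-map i quo (zipWith combine u v))
                          (trans (cong quo (lookup-zipWith combine i u v)) (quotient-combine (lookup u i) (lookup v i))))
      (lookup-ext λ i → trans (lookup-map i rem (zipWith combine u v))
                          (trans (cong rem (lookup-zipWith combine i u v)) (remainder-combine (lookup u i) (lookup v i))))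
  })
  where
  quo : Fin (a * b) → Fin a
  quo = quotient b
  rem : Fin (a * b) → Fin b
  rem = remainder {a} b

disjointCycles : (k m : ℕ) .{{_ : NonZero k}} → 2 ≤ m → Graph
disjointCycles k m 2≤m = record
  { order    = k * m
  ; nonEmpty = *-mono-≤ (>-nonZero⁻¹ k) (≤-trans (n≤1+n 1) 2≤m)
  ; adj      = diagonal k ⊗ cycleAdj m
  ; sym      = ⊗-sym (diagonal k) (cycleAdj m) diagonal-sym cycleAdj-sym
  ; irrefl   = ⊗-irreflexiveʳ (diagonal k) (cycleAdj m) (cycleAdj-irrefl 2≤m)
  }

disjointCycles-¬IsCycle : ∀ k m .{{_ : NonZero k}} (2≤m : 2 ≤ m) → 2 ≤ k → ¬ IsCycle (disjointCycles k m 2≤m)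
disjointCycles-¬IsCycle k@(suc (suc _)) m@(suc _) 2≤m _ (_ , _ , iso) = 0≢1 (begin
  zero                    ≡⟨ quotient-combine {k} {m} zero zero ⟨
  quotient m (block zero) ≡⟨ IsoToCycle-connected (disjointCycles k m 2≤m) iso (quotient m) same-block
                                                  (block zero) (block one) ⟩
  quotient m (block one)  ≡⟨ quotient-combine {k} {m} one zero ⟩
  one                     ∎)
  where
  open ≡-Reasoning
  one : Fin k
  one = suc zero
  block : Fin k → Fin (k * m)
  block i = combine i zero
  same-block : ∀ x y → T ((diagonal k ⊗ cycleAdj m) x y) → quotient {k} m x ≡ quotient m y
  same-block x y e = toWitness (proj₁ (Equivalence.to (T-∧ {diagonal k (quotient m x) (quotient m y)}) e))
  0≢1 : zero ≢ one
  0≢1 ()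
disjointCycles-¬IsCycle (suc zero) _ _ (s≤s ())

-- Bipartite graphs

infixl 6 _⊕_

_⊕_ : Fin 2 → Fin 2 → Fin 2
x     ⊕ zero  = x
zero  ⊕ suc _ = suc zero
suc _ ⊕ suc _ = zero

⊕-involutive : (x c : Fin 2) → x ⊕ c ⊕ c ≡ x
⊕-involutive zero       zero       = refl
⊕-involutive zero       (suc zero) = refl
⊕-involutive (suc zero) zero       = refl
⊕-involutive (suc zero) (suc zero) = refl

cycleAdj-2-⊕ : {c c′ : Fin 2} → T (cycleAdj 2 c c′) →
               (x x′ : Fin 2) → T (cycleAdj 2 x x′) ⇔ (x ⊕ c ≡ x′ ⊕ c′)
cycleAdj-2-⊕ {zero}     {zero}     ()
cycleAdj-2-⊕ {suc zero} {suc zero} ()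
cycleAdj-2-⊕ {zero}     {suc zero} _ zero       zero       = mk⇔ (λ ()) (λ ())
cycleAdj-2-⊕ {zero}     {suc zero} _ zero       (suc zero) = mk⇔ (λ _ → refl) _
cycleAdj-2-⊕ {zero}     {suc zero} _ (suc zero) zero       = mk⇔ (λ _ → refl) _
cycleAdj-2-⊕ {zero}     {suc zero} _ (suc zero) (suc zero) = mk⇔ (λ ()) (λ ())
cycleAdj-2-⊕ {suc zero} {zero}     _ zero       zero       = mk⇔ (λ ()) (λ ())
cycleAdj-2-⊕ {suc zero} {zero}     _ zero       (suc zero) = mk⇔ (λ _ → refl) _
cycleAdj-2-⊕ {suc zero} {zero}     _ (suc zero) zero       = mk⇔ (λ _ → refl) _
cycleAdj-2-⊕ {suc zero} {zero}     _ (suc zero) (suc zero) = mk⇔ (λ ()) (λ ())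

-- Adding a fixed 2-colouring c (mod 2) turns 2-colourings into maps constant on components.
homTo-cycleAdj-2-bipartite : (F : Graph) (c : Vec (Fin 2) (order F)) → IsHomTo F (cycleAdj 2) c →
                             homTo F (cycleAdj 2) ≡ homTo F (diagonal 2)
homTo-cycleAdj-2-bipartite F c c-hom = homTo-correspondence F (cycleAdj 2) (diagonal 2) (record
  { to        = recolour
  ; from      = recolour
  ; to-resp   = λ {g} g-hom i j e → Equivalence.from (T-diagonal _ _)
      (trans (recolour-lookup g i)
        (trans (Equivalence.to (⊕-c (c-hom i j e) (lookup g i) (lookup g j)) (g-hom i j e)) (sym (recolour-lookup g j))))
  ; from-resp = λ {h} h-hom i j e → Equivalence.from (⊕-c (c-hom i j e) (lookup (recolour h) i) (lookup (recolour h) j))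
      (trans (recolour-twice h i) (trans (Equivalence.to (T-diagonal _ _) (h-hom i j e)) (sym (recolour-twice h j))))
  ; from∘to   = λ {g} _ → recolour-involutive g
  ; to∘from   = λ {h} _ → recolour-involutive h
  })
  where
  ⊕-c : ∀ {i j} → T (cycleAdj 2 (lookup c i) (lookup c j)) → (x x′ : Fin 2) →
        T (cycleAdj 2 x x′) ⇔ (x ⊕ lookup c i ≡ x′ ⊕ lookup c j)
  ⊕-c = cycleAdj-2-⊕
  recolour : Vec (Fin 2) (order F) → Vec (Fin 2) (order F)
  recolour g = zipWith _⊕_ g c
  recolour-lookup : ∀ g i → lookup (recolour g) i ≡ lookup g i ⊕ lookup c i
  recolour-lookup g i = lookup-zipWith _⊕_ i g c
  recolour-twice : ∀ g i → lookup (recolour g) i ⊕ lookup c i ≡ lookup g i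
  recolour-twice g i = trans (cong (_⊕ lookup c i) (recolour-lookup g i)) (⊕-involutive (lookup g i) (lookup c i))
  recolour-involutive : ∀ g → recolour (recolour g) ≡ g
  recolour-involutive g = lookup-ext λ i → trans (recolour-lookup (recolour g) i) (recolour-twice g i)

-- Even cycles of odd half-length

≢⇒Step-2 : x < 2 → y < 2 → x ≢ y → Step 2 x y
≢⇒Step-2 {0} {0} _ _ x≢y = contradiction refl x≢y
≢⇒Step-2 {0} {1} _ _ _   = refl
≢⇒Step-2 {1} {0} _ _ _   = refl
≢⇒Step-2 {1} {1} _ _ x≢y = contradiction refl x≢y
≢⇒Step-2 {suc (suc _)} (s≤s (s≤s ()))
≢⇒Step-2 {y = suc (suc _)} _ (s≤s (s≤s ()))

Step-2-either : x < 2 → y < 2 → Step 2 x y ⊎ Step 2 y x → Step 2 x y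
Step-2-either x<2 y<2 = [ id , (λ step → ≢⇒Step-2 x<2 y<2 λ { refl → Step-irrefl ≤-refl x<2 step }) ]′

module OddModulus (m : ℕ) .{{_ : NonZero m}} (m-odd : m % 2 ≡ 1) where

  private instance
    m*2-nonZero : NonZero (m * 2)
    m*2-nonZero = m*n≢0 m 2

  +m-%2 : ∀ x → (x + m) % 2 ≡ suc (x % 2) % 2
  +m-%2 x = begin
    (x + m) % 2         ≡⟨ %-distribˡ-+ x m 2 ⟩
    (x % 2 + m % 2) % 2 ≡⟨ cong (λ z → (x % 2 + z) % 2) m-odd ⟩
    (x % 2 + 1) % 2     ≡⟨ cong (_% 2) (+-comm (x % 2) 1) ⟩
    suc (x % 2) % 2     ∎
    where open ≡-Reasoning

  <m*2-cases : x < m * 2 → x ≡ x % m ⊎ x ≡ x % m + m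
  <m*2-cases {x} x<m*2 with x / m | m<n*o⇒m/o<n {x} {2} {m} (subst (x <_) (*-comm m 2) x<m*2) | m≡m%n+[m/n]*n x m
  ... | 0           | _            | x≡ = inj₁ (trans x≡ (+-identityʳ _))
  ... | 1           | _            | x≡ = inj₂ (trans x≡ (cong (x % m +_) (+-identityʳ m)))
  ... | suc (suc _) | s≤s (s≤s ()) | _

  crt-unique : x < m * 2 → y < m * 2 → x % m ≡ y % m → x % 2 ≡ y % 2 → x ≡ y
  crt-unique {x} {y} x< y< x≡y[m] x≡y[2] with <m*2-cases x< | <m*2-cases y<
  ... | inj₁ x≡r   | inj₁ y≡r   = trans x≡r (trans x≡y[m] (sym y≡r))
  ... | inj₂ x≡r+m | inj₂ y≡r+m = trans x≡r+m (trans (cong (_+ m) x≡y[m]) (sym y≡r+m))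
  ... | inj₁ x≡r   | inj₂ y≡r+m = contradiction (trans (sym (+m-%2 (y % m))) (begin
        (y % m + m) % 2 ≡⟨ cong (_% 2) y≡r+m ⟨
        y % 2           ≡⟨ x≡y[2] ⟨
        x % 2           ≡⟨ cong (_% 2) (trans x≡r x≡y[m]) ⟩
        y % m % 2       ∎)) (Step-irrefl ≤-refl (m%n<n (y % m) 2))
    where open ≡-Reasoning
  ... | inj₂ x≡r+m | inj₁ y≡r   = contradiction (trans (sym (+m-%2 (x % m))) (begin
        (x % m + m) % 2 ≡⟨ cong (_% 2) x≡r+m ⟨
        x % 2           ≡⟨ x≡y[2] ⟩
        y % 2           ≡⟨ cong (_% 2) (trans y≡r (sym x≡y[m])) ⟩
        x % m % 2       ∎)) (Step-irrefl ≤-refl (m%n<n (x % m) 2))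
    where open ≡-Reasoning

  -- The solution x < 2m of x ≡ a (mod m), x ≡ b (mod 2): one of a and a + m, which have
  -- different parities since m is odd.
  crt : ℕ → ℕ → ℕ
  crt a b = if a % 2 ≡ᵇ b then a else a + m

  crt-residues : a < m → b < 2 → crt a b % m ≡ a × crt a b % 2 ≡ b
  crt-residues {a} {b} a<m b<2 with a % 2 ≡ᵇ b in a≡b[2]
  ... | true  = m<n⇒m%n≡m a<m , ≡ᵇ⇒≡ _ _ (subst T (sym a≡b[2]) _)
  ... | false = trans ([m+n]%n≡m%n a m) (m<n⇒m%n≡m a<m) ,
                trans (+m-%2 a) (≢⇒Step-2 (m%n<n a 2) b<2 λ eq → subst T a≡b[2] (≡⇒≡ᵇ _ _ eq))

  crt-< : ∀ b → a < m → crt a b < m * 2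
  crt-< {a} b a<m with a % 2 ≡ᵇ b
  ... | true  = ≤-trans a<m (m≤m*n m 2)
  ... | false = subst (a + m <_) (sym (trans (*-comm m 2) (cong (m +_) (+-identityʳ m)))) (+-monoˡ-< m a<m)

  Step-double⇔ : x < m * 2 → y < m * 2 → Step (m * 2) x y ⇔ (Step m (x % m) (y % m) × Step 2 (x % 2) (y % 2))
  Step-double⇔ {x} {y} x< y< = mk⇔
    (λ step → Step-mod (m∣m*n 2) step , Step-mod (n∣m*n m) step)
    (λ (step-m , step-2) → crt-unique (m%n<n (suc x) (m * 2)) y<
       (trans (m∣n⇒o%n%m≡o%m m (m * 2) (suc x) (m∣m*n 2)) (trans (sym (%-suc x m)) step-m))
       (trans (m∣n⇒o%n%m≡o%m 2 (m * 2) (suc x) (n∣m*n m)) (trans (sym (%-suc x 2)) step-2)))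

  private
    toℕ-mod : ∀ x d .{{_ : NonZero d}} → toℕ (x mod d) ≡ x % d
    toℕ-mod x d = toℕ-fromℕ< (m%n<n x d)

  residues : Fin (m * 2) → Fin (m * 2)
  residues x = combine (toℕ x mod m) (toℕ x mod 2)

  fromResidues : Fin (m * 2) → Fin (m * 2)
  fromResidues y = fromℕ< (crt-< (toℕ (remainder {m} 2 y)) (toℕ<n (quotient {m} 2 y)))

  toℕ-fromResidues : ∀ y → toℕ (fromResidues y) ≡ crt (toℕ (quotient {m} 2 y)) (toℕ (remainder {m} 2 y))
  toℕ-fromResidues y = toℕ-fromℕ< _

  residues∘fromResidues : ∀ y → residues (fromResidues y) ≡ y
  residues∘fromResidues y = begin
    combine (toℕ (fromResidues y) mod m) (toℕ (fromResidues y) mod 2)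
      ≡⟨ cong₂ combine (toℕ-injective (residue≡ m (proj₁ crt-y))) (toℕ-injective (residue≡ 2 (proj₂ crt-y))) ⟩
    combine (quotient {m} 2 y) (remainder {m} 2 y)
      ≡⟨ combine-remQuot {m} 2 y ⟩
    y ∎
    where
    open ≡-Reasoning
    y₁ = toℕ (quotient {m} 2 y)
    y₂ = toℕ (remainder {m} 2 y)
    crt-y : crt y₁ y₂ % m ≡ y₁ × crt y₁ y₂ % 2 ≡ y₂
    crt-y = crt-residues (toℕ<n (quotient {m} 2 y)) (toℕ<n (remainder {m} 2 y))
    residue≡ : ∀ d .{{_ : NonZero d}} {z} → crt y₁ y₂ % d ≡ z → toℕ (toℕ (fromResidues y) mod d) ≡ z
    residue≡ d eq = trans (toℕ-mod (toℕ (fromResidues y)) d) (trans (cong (_% d) (toℕ-fromResidues y)) eq)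

  fromResidues∘residues : ∀ x → fromResidues (residues x) ≡ x
  fromResidues∘residues x = toℕ-injective (crt-unique (toℕ<n (fromResidues (residues x))) (toℕ<n x)
    (trans (cong (_% m) c≡) (proj₁ crt-x)) (trans (cong (_% 2) c≡) (proj₂ crt-x)))
    where
    open ≡-Reasoning
    x₁ = toℕ x % m
    x₂ = toℕ x % 2
    c≡ : toℕ (fromResidues (residues x)) ≡ crt x₁ x₂
    c≡ = begin
      toℕ (fromResidues (residues x))
        ≡⟨ toℕ-fromResidues (residues x) ⟩
      crt (toℕ (quotient {m} 2 (residues x))) (toℕ (remainder {m} 2 (residues x)))
        ≡⟨ cong₂ crt
             (trans (cong toℕ (quotient-combine {m} {2} (toℕ x mod m) (toℕ x mod 2))) (toℕ-mod (toℕ x) m))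
             (trans (cong toℕ (remainder-combine {m} {2} (toℕ x mod m) (toℕ x mod 2))) (toℕ-mod (toℕ x) 2)) ⟩
      crt x₁ x₂ ∎
    crt-x : crt x₁ x₂ % m ≡ x₁ × crt x₁ x₂ % 2 ≡ x₂
    crt-x = crt-residues (m%n<n (toℕ x) m) (m%n<n (toℕ x) 2)

  residues-adj : ∀ x y → (cycleAdj m ⊗ cycleAdj 2) (residues x) (residues y) ≡ cycleAdj (m * 2) x y
  residues-adj x y = begin
    (cycleAdj m ⊗ cycleAdj 2) (residues x) (residues y)
      ≡⟨ ⊗-combine (cycleAdj m) (cycleAdj 2) (toℕ x mod m) (toℕ x mod 2) (toℕ y mod m) (toℕ y mod 2) ⟩
    adj-residues
      ≡⟨ T-injective (mk⇔ from-residues to-residues) ⟩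
    cycleAdj (m * 2) x y ∎
    where
    open ≡-Reasoning
    x′ = toℕ x
    y′ = toℕ y
    adj-residues : Bool
    adj-residues = cycleAdj m (x′ mod m) (y′ mod m) ∧ cycleAdj 2 (x′ mod 2) (y′ mod 2)
    from-residues : T adj-residues → T (cycleAdj (m * 2) x y)
    from-residues t with (adj-m , adj-2) ← Equivalence.to T-∧ t
                    with Equivalence.to (T-cycleAdj-mod m x′ y′) adj-m
                       | Equivalence.to (T-cycleAdj-mod 2 x′ y′) adj-2
    ... | inj₁ step-m | steps-2 = Equivalence.from (T-cycleAdj x y) (inj₁ (Equivalence.from
          (Step-double⇔ (toℕ<n x) (toℕ<n y)) (step-m , Step-2-either (m%n<n x′ 2) (m%n<n y′ 2) steps-2)))
    ... | inj₂ step-m | steps-2 = Equivalence.from (T-cycleAdj x y) (inj₂ (Equivalence.from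
          (Step-double⇔ (toℕ<n y) (toℕ<n x)) (step-m , Step-2-either (m%n<n y′ 2) (m%n<n x′ 2) (swap steps-2))))
    to-residues : T (cycleAdj (m * 2) x y) → T adj-residues
    to-residues t with Equivalence.to (T-cycleAdj x y) t
    ... | inj₁ step = let (step-m , step-2) = Equivalence.to (Step-double⇔ (toℕ<n x) (toℕ<n y)) step in
          Equivalence.from T-∧ (Equivalence.from (T-cycleAdj-mod m x′ y′) (inj₁ step-m) ,
                                Equivalence.from (T-cycleAdj-mod 2 x′ y′) (inj₁ step-2))
    ... | inj₂ step = let (step-m , step-2) = Equivalence.to (Step-double⇔ (toℕ<n y) (toℕ<n x)) step in
          Equivalence.from T-∧ (Equivalence.from (T-cycleAdj-mod m x′ y′) (inj₂ step-m) ,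
                                Equivalence.from (T-cycleAdj-mod 2 x′ y′) (inj₂ step-2))

  crtIso : Fin (m * 2) ↔ Fin (m * 2)
  crtIso = mk↔ₛ′ residues fromResidues residues∘fromResidues fromResidues∘residues

homTo-cycleAdj-double : (F : Graph) (m : ℕ) .{{_ : NonZero m}} → m % 2 ≡ 1 →
                        homTo F (cycleAdj (m * 2)) ≡ homTo F (cycleAdj m) * homTo F (cycleAdj 2)
homTo-cycleAdj-double F m m-odd = trans
  (homTo-↔ F (cycleAdj (m * 2)) (cycleAdj m ⊗ cycleAdj 2) crtIso residues-adj)
  (homTo-⊗ F (cycleAdj m) (cycleAdj 2))
  where open OddModulus m m-odd

homTo-cycleAdj-double≡0 : (F : Graph) (m : ℕ) .{{_ : NonZero m}} → m % 2 ≡ 1 →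
                          homTo F (cycleAdj 2) ≡ 0 → homTo F (cycleAdj (m * 2)) ≡ 0
homTo-cycleAdj-double≡0 F m m-odd no-2-colouring = begin
  homTo F (cycleAdj (m * 2))                  ≡⟨ homTo-cycleAdj-double F m m-odd ⟩
  homTo F (cycleAdj m) * homTo F (cycleAdj 2) ≡⟨ cong (homTo F (cycleAdj m) *_) no-2-colouring ⟩
  homTo F (cycleAdj m) * 0                    ≡⟨ *-zeroʳ (homTo F (cycleAdj m)) ⟩
  0                                           ∎
  where open ≡-Reasoning

-- Cutting long cycles open

%-absorbˡ-+ : ∀ x y d .{{_ : NonZero d}} → (x % d + y) % d ≡ (x + y) % d
%-absorbˡ-+ x y d = begin
  (x % d + y) % d         ≡⟨ %-distribˡ-+ (x % d) y d ⟩
  (x % d % d + y % d) % d ≡⟨ cong (λ z → (z + y % d) % d) (m%n%n≡m%n x d) ⟩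
  (x % d + y % d) % d     ≡⟨ %-distribˡ-+ x y d ⟨
  (x + y) % d             ∎
  where open ≡-Reasoning

shift : (n : ℕ) .{{_ : NonZero n}} → ℕ → ℕ → ℕ
shift n s x = (x + s) % n

shift-< : ∀ .{{_ : NonZero n}} s x → shift n s x < n
shift-< {n} s x = m%n<n (x + s) n

shift-step : ∀ .{{_ : NonZero n}} s → Step n x y → Step n (shift n s x) (shift n s y)
shift-step {n} {x} {y} s step = begin
  suc ((x + s) % n) % n ≡⟨ %-suc (x + s) n ⟩
  (suc x + s) % n       ≡⟨ %-absorbˡ-+ (suc x) s n ⟨
  (suc x % n + s) % n   ≡⟨ cong (λ z → (z + s) % n) step ⟩
  (y + s) % n           ∎
  where open ≡-Reasoning

shift-mod : ∀ {d} .{{_ : NonZero d}} .{{_ : NonZero n}} → d ∣ n → ∀ s x → shift n s x % d ≡ shift d s (x % d)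
shift-mod {n} {d} d∣n s x = begin
  (x + s) % n % d ≡⟨ m∣n⇒o%n%m≡o%m d n (x + s) d∣n ⟩
  (x + s) % d     ≡⟨ %-absorbˡ-+ x s d ⟨
  (x % d + s) % d ∎
  where open ≡-Reasoning

shift-cancel : ∀ .{{_ : NonZero n}} {s t} → n ∣ s + t → x < n → shift n t (shift n s x) ≡ x
shift-cancel {n} {x} {s} {t} n∣s+t x<n = begin
  ((x + s) % n + t) % n ≡⟨ %-absorbˡ-+ (x + s) t n ⟩
  (x + s + t) % n       ≡⟨ cong (_% n) (+-assoc x s t) ⟩
  (x + (s + t)) % n     ≡⟨ %-remove-+ʳ x n∣s+t ⟩
  x % n                 ≡⟨ m<n⇒m%n≡m x<n ⟩
  x                     ∎
  where open ≡-Reasoning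

-- Shifting by m ∸ suc μ moves μ to the last residue m ∸ 1, so every other residue has a successor.
shift-past-gap : ∀ {m μ a} .{{_ : NonZero m}} → μ < m → a < m → a ≢ μ → suc (shift m (m ∸ suc μ) a) < m
shift-past-gap {m} {μ} {a} μ<m a<m a≢μ with m≤n⇒m<n∨m≡n (shift-< {m} (m ∸ suc μ) a)
... | inj₁ 1+x<m = 1+x<m
... | inj₂ 1+x≡m = contradiction (begin
  a                                     ≡⟨ shift-cancel (subst (m ∣_) (sym (m∸n+n≡m μ<m)) ∣-refl) a<m ⟨
  (shift m (m ∸ suc μ) a + suc μ) % m   ≡⟨ cong (_% m) (+-suc _ μ) ⟩
  (suc (shift m (m ∸ suc μ) a) + μ) % m ≡⟨ cong (λ z → (z + μ) % m) 1+x≡m ⟩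
  (m + μ) % m                           ≡⟨ cong (_% m) (+-comm m μ) ⟩
  (μ + m) % m                           ≡⟨ [m+n]%n≡m%n μ m ⟩
  μ % m                                 ≡⟨ m<n⇒m%n≡m μ<m ⟩
  μ                                     ∎) a≢μ
  where open ≡-Reasoning

missing-value : ∀ {r m} → r < m → (u : Vec (Fin m) r) → ∃ λ μ → ∀ i → lookup u i ≢ μ
missing-value {r} {m} r<m u with any? (λ μ → all? (λ i → ¬? (lookup u i ≟ μ)))
... | yes μ-missed = μ-missed
... | no ¬missed   = contradiction (pigeonhole r<m preimage) no-collision
  where
  hit : ∀ μ → ∃ λ i → lookup u i ≡ μ
  hit μ with i , ¬≢ ← ¬∀⟶∃¬ r _ (λ i → ¬? (lookup u i ≟ μ)) (λ missed → ¬missed (μ , missed)) =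
    i , decidable-stable (lookup u i ≟ μ) ¬≢
  preimage : Fin m → Fin r
  preimage μ = proj₁ (hit μ)
  no-collision : ¬ ∃₂ λ μ μ′ → μ Data.Fin.< μ′ × preimage μ ≡ preimage μ′
  no-collision (μ , μ′ , μ<μ′ , same-preimage) = Fin.<⇒≢ μ<μ′ (begin
    μ                      ≡⟨ proj₂ (hit μ) ⟨
    lookup u (preimage μ)  ≡⟨ cong (lookup u) same-preimage ⟩
    lookup u (preimage μ′) ≡⟨ proj₂ (hit μ′) ⟩
    μ′                     ∎)
    where open ≡-Reasoning

-- After rotating C_{m * k} by s, vertex x lies in block (block s x) at residue x % m, and
-- position s a e is the vertex at residue a in block e.
module Blocks (m k : ℕ) .{{_ : NonZero m}} .{{_ : NonZero k}} where

  private instance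
    m*k-nonZero : NonZero (m * k)
    m*k-nonZero = m*n≢0 m k

  block-< : ∀ {a e} → a < m → e < k → a + e * m < m * k
  block-< {a} {e} a<m e<k = begin-strict
    a + e * m <⟨ +-monoˡ-< (e * m) a<m ⟩
    suc e * m ≤⟨ *-monoˡ-≤ m e<k ⟩
    k * m     ≡⟨ *-comm k m ⟩
    m * k     ∎
    where open ≤-Reasoning

  block-% : ∀ {a} e → a < m → (a + e * m) % m ≡ a
  block-% {a} e a<m = trans ([m+kn]%n≡m%n a e m) (m<n⇒m%n≡m a<m)

  block-/ : ∀ {a} e → a < m → (a + e * m) / m ≡ e
  block-/ {a} e a<m = trans (+-distrib-/-∣ʳ a (n∣m*n e)) (cong₂ _+_ (m<n⇒m/n≡0 a<m) (m*n/n≡m e m))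

  /-< : x < m * k → x / m < k
  /-< {x} x<m*k = m<n*o⇒m/o<n (subst (x <_) (*-comm m k) x<m*k)

  Step-within-block : x < m * k → suc (x % m) < m → Step (m * k) x y → x / m ≡ y / m
  Step-within-block {x} {y} x<m*k 1+x%m<m step = begin
    x / m                         ≡⟨ block-/ (x / m) 1+x%m<m ⟨
    (suc (x % m) + x / m * m) / m ≡⟨ cong (λ z → suc z / m) x≡ ⟨
    suc x / m                     ≡⟨ cong (_/ m) (m<n⇒m%n≡m 1+x<m*k) ⟨
    suc x % (m * k) / m           ≡⟨ cong (_/ m) step ⟩
    y / m                         ∎
    where
    open ≡-Reasoning
    x≡ : x ≡ x % m + x / m * m
    x≡ = m≡m%n+[m/n]*n x m
    1+x<m*k : suc x < m * k
    1+x<m*k = subst (_< m * k) (cong suc (sym x≡)) (block-< 1+x%m<m (/-< x<m*k))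

  Step-block : ∀ {a e} → suc a < m → e < k → Step (m * k) (a + e * m) (suc a + e * m)
  Step-block 1+a<m e<k = m<n⇒m%n≡m (block-< 1+a<m e<k)

  block : ℕ → ℕ → ℕ
  block s x = shift (m * k) s x / m

  position : ℕ → ℕ → ℕ → ℕ
  position s a e = shift (m * k) (m * k ∸ s) (shift m s a + e * m)

  module _ {s : ℕ} (s≤m : s ≤ m) where

    private
      s≤m*k : s ≤ m * k
      s≤m*k = ≤-trans s≤m (m≤m*n m k)

    position-% : ∀ {a e} → a < m → e < k → position s a e % m ≡ a
    position-% {a} {e} a<m e<k = begin
      position s a e % m
        ≡⟨ shift-mod (m∣m*n k) (m * k ∸ s) _ ⟩
      shift m (m * k ∸ s) ((shift m s a + e * m) % m)
        ≡⟨ cong (shift m (m * k ∸ s)) (block-% e (shift-< s a)) ⟩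
      shift m (m * k ∸ s) (shift m s a)
        ≡⟨ shift-cancel (subst (m ∣_) (sym (m+[n∸m]≡n s≤m*k)) (m∣m*n k)) a<m ⟩
      a ∎
      where open ≡-Reasoning

    block-position : ∀ {a e} → a < m → e < k → block s (position s a e) ≡ e
    block-position {a} {e} a<m e<k = begin
      shift (m * k) s (position s a e) / m
        ≡⟨ cong (_/ m) (shift-cancel (subst (m * k ∣_) (sym (m∸n+n≡m s≤m*k)) ∣-refl)
                                     (block-< (shift-< s a) e<k)) ⟩
      (shift m s a + e * m) / m
        ≡⟨ block-/ e (shift-< s a) ⟩
      e ∎
      where open ≡-Reasoning

    position-block : x < m * k → position s (x % m) (block s x) ≡ x
    position-block {x} x<m*k = begin
      shift (m * k) (m * k ∸ s) (shift m s (x % m) + block s x * m)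
        ≡⟨ cong (λ z → shift (m * k) (m * k ∸ s) (z + block s x * m)) (shift-mod (m∣m*n k) s x) ⟨
      shift (m * k) (m * k ∸ s) (shift (m * k) s x % m + block s x * m)
        ≡⟨ cong (shift (m * k) (m * k ∸ s)) (m≡m%n+[m/n]*n (shift (m * k) s x) m) ⟨
      shift (m * k) (m * k ∸ s) (shift (m * k) s x)
        ≡⟨ shift-cancel (subst (m * k ∣_) (sym (m+[n∸m]≡n s≤m*k)) ∣-refl) x<m*k ⟩
      x ∎
      where open ≡-Reasoning

  module _ {μ : ℕ} (μ<m : μ < m) where

    private
      s = m ∸ suc μ

    Step-preserves-block : x < m * k → x % m ≢ μ → Step (m * k) x y → block s x ≡ block s y
    Step-preserves-block {x} x<m*k x≢μ step = Step-within-block (shift-< s x)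
      (subst (λ z → suc z < m) (sym (shift-mod (m∣m*n k) s x)) (shift-past-gap μ<m (m%n<n x m) x≢μ))
      (shift-step {m * k} s step)

    Step-position : ∀ {a a′ e} → a < m → a ≢ μ → e < k → Step m a a′ →
                    Step (m * k) (position s a e) (position s a′ e)
    Step-position {a} {a′} {e} a<m a≢μ e<k step = shift-step {m * k} (m * k ∸ s)
      (subst (λ z → Step (m * k) (shift m s a + e * m) (z + e * m)) next≡ (Step-block 1+sa<m e<k))
      where
      1+sa<m : suc (shift m s a) < m
      1+sa<m = shift-past-gap μ<m a<m a≢μ
      next≡ : suc (shift m s a) ≡ shift m s a′
      next≡ = trans (sym (m<n⇒m%n≡m 1+sa<m)) (shift-step {m} s step)

-- A homomorphism f : F → C_{m * k} with |V(F)| < m misses some residue μ of f mod m.  Rotated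
-- so that μ is the last residue of each block, f never crosses between blocks, so f is
-- determined by f mod m and the block of each vertex, which is constant on components.
module Lift (F : Graph) (m k : ℕ) .{{_ : NonZero m}} .{{_ : NonZero k}} (r<m : order F < m) where

  open Blocks m k

  private instance
    m*k-nonZero : NonZero (m * k)
    m*k-nonZero = m*n≢0 m k

  Maps : ℕ → Set
  Maps d = Vec (Fin d) (order F)

  residuesOf : Maps (m * k) → Maps m
  residuesOf = map (λ x → toℕ x mod m)

  gap : Maps m → Fin m
  gap u = proj₁ (missing-value r<m u)

  rotation : Maps m → ℕ
  rotation u = m ∸ suc (toℕ (gap u))

  blockFin : ℕ → Fin (m * k) → Fin k
  blockFin s x = fromℕ< (/-< (shift-< s (toℕ x)))

  positionFin : ℕ → Fin m → Fin k → Fin (m * k)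
  positionFin s a e = (shift m s (toℕ a) + toℕ e * m + (m * k ∸ s)) mod (m * k)

  split : Maps (m * k) → Maps m × Maps k
  split f = residuesOf f , map (blockFin (rotation (residuesOf f))) f

  assemble : Maps m × Maps k → Maps (m * k)
  assemble (u , e) = zipWith (positionFin (rotation u)) u e

  private
    gap-missed : ∀ u i → toℕ (lookup u i) ≢ toℕ (gap u)
    gap-missed u i eq = proj₂ (missing-value r<m u) i (toℕ-injective eq)

    rotation≤m : ∀ u → rotation u ≤ m
    rotation≤m u = m∸n≤m m (suc (toℕ (gap u)))

    lookup-residuesOf : ∀ (f : Maps (m * k)) i → toℕ (lookup (residuesOf f) i) ≡ toℕ (lookup f i) % m
    lookup-residuesOf f i = trans (cong toℕ (lookup-map i (λ x → toℕ x mod m) f)) (toℕ-fromℕ< _)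

    lookup-blocks : ∀ s (f : Maps (m * k)) i → toℕ (lookup (map (blockFin s) f) i) ≡ block s (toℕ (lookup f i))
    lookup-blocks s f i = trans (cong toℕ (lookup-map i (blockFin s) f)) (toℕ-fromℕ< _)

    lookup-assemble : ∀ u e i →
                      toℕ (lookup (assemble (u , e)) i) ≡ position (rotation u) (toℕ (lookup u i)) (toℕ (lookup e i))
    lookup-assemble u e i = trans (cong toℕ (lookup-zipWith (positionFin (rotation u)) i u e)) (toℕ-fromℕ< _)

  split-resp : ∀ f → IsHomTo F (cycleAdj (m * k)) f →
               (IsHomTo F (cycleAdj m) ⟨×⟩ IsHomTo F (diagonal k)) (split f)
  split-resp f f-hom = IsHomTo-residues F m (m∣m*n k) f f-hom , λ i j e →
    Equivalence.from (T-diagonal _ _) (toℕ-injective (begin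
      toℕ (lookup (blocks f) i) ≡⟨ lookup-blocks s f i ⟩
      block s (v i)             ≡⟨ same-block i j (Equivalence.to (T-cycleAdj (lookup f i) (lookup f j)) (f-hom i j e)) ⟩
      block s (v j)             ≡⟨ lookup-blocks s f j ⟨
      toℕ (lookup (blocks f) j) ∎))
    where
    open ≡-Reasoning
    u = residuesOf f
    s = rotation u
    blocks : Maps (m * k) → Maps k
    blocks = map (blockFin s)
    v : Fin (order F) → ℕ
    v i = toℕ (lookup f i)
    off-gap : ∀ i → v i % m ≢ toℕ (gap u)
    off-gap i = gap-missed u i ∘′ trans (lookup-residuesOf f i)
    same-block : ∀ i j → Step (m * k) (v i) (v j) ⊎ Step (m * k) (v j) (v i) → block s (v i) ≡ block s (v j)
    same-block i j (inj₁ step) = Step-preserves-block (toℕ<n (gap u)) (toℕ<n (lookup f i)) (off-gap i) step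
    same-block i j (inj₂ step) = sym (Step-preserves-block (toℕ<n (gap u)) (toℕ<n (lookup f j)) (off-gap j) step)

  assemble-resp : ∀ u e → (IsHomTo F (cycleAdj m) ⟨×⟩ IsHomTo F (diagonal k)) (u , e) →
                  IsHomTo F (cycleAdj (m * k)) (assemble (u , e))
  assemble-resp u e (u-hom , e-hom) i j adj-ij =
    Equivalence.from (T-cycleAdj (lookup (assemble (u , e)) i) (lookup (assemble (u , e)) j))
      (subst₂ (λ p q → Step (m * k) p q ⊎ Step (m * k) q p) (sym (lookup-assemble u e i)) (sym (lookup-assemble u e j))
        (steps (Equivalence.to (T-cycleAdj (lookup u i) (lookup u j)) (u-hom i j adj-ij))))
    where
    s = rotation u
    res : Fin (order F) → ℕ
    res i = toℕ (lookup u i)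
    blk : Fin (order F) → ℕ
    blk i = toℕ (lookup e i)
    blk-const : blk i ≡ blk j
    blk-const = cong toℕ (Equivalence.to (T-diagonal _ _) (e-hom i j adj-ij))
    step-from : ∀ i j → blk i ≡ blk j → Step m (res i) (res j) →
                Step (m * k) (position s (res i) (blk i)) (position s (res j) (blk j))
    step-from i j blkᵢ≡blkⱼ step = subst (λ z → Step (m * k) _ (position s (res j) z)) blkᵢ≡blkⱼ
      (Step-position (toℕ<n (gap u)) (toℕ<n (lookup u i)) (gap-missed u i) (toℕ<n (lookup e i)) step)
    steps : Step m (res i) (res j) ⊎ Step m (res j) (res i) →
            Step (m * k) (position s (res i) (blk i)) (position s (res j) (blk j)) ⊎
            Step (m * k) (position s (res j) (blk j)) (position s (res i) (blk i))
    steps (inj₁ step) = inj₁ (step-from i j blk-const step)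
    steps (inj₂ step) = inj₂ (step-from j i (sym blk-const) step)

  assemble∘split : ∀ f → assemble (split f) ≡ f
  assemble∘split f = lookup-ext λ i → toℕ-injective (begin
    toℕ (lookup (assemble (split f)) i)
      ≡⟨ lookup-assemble (residuesOf f) _ i ⟩
    position s (toℕ (lookup (residuesOf f) i)) (toℕ (lookup (map (blockFin s) f) i))
      ≡⟨ cong₂ (position s) (lookup-residuesOf f i) (lookup-blocks s f i) ⟩
    position s (toℕ (lookup f i) % m) (block s (toℕ (lookup f i)))
      ≡⟨ position-block (rotation≤m (residuesOf f)) (toℕ<n (lookup f i)) ⟩
    toℕ (lookup f i) ∎)
    where
    open ≡-Reasoning
    s = rotation (residuesOf f)

  split∘assemble : ∀ u e → split (assemble (u , e)) ≡ (u , e)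
  split∘assemble u e =
    cong₂ _,_ residues≡ (trans (cong (λ v → map (blockFin (rotation v)) f) residues≡) blocks≡)
    where
    open ≡-Reasoning
    f = assemble (u , e)
    s = rotation u
    residues≡ : residuesOf f ≡ u
    residues≡ = lookup-ext λ i → toℕ-injective (begin
      toℕ (lookup (residuesOf f) i)
        ≡⟨ lookup-residuesOf f i ⟩
      toℕ (lookup f i) % m
        ≡⟨ cong (_% m) (lookup-assemble u e i) ⟩
      position s (toℕ (lookup u i)) (toℕ (lookup e i)) % m
        ≡⟨ position-% (rotation≤m u) (toℕ<n (lookup u i)) (toℕ<n (lookup e i)) ⟩
      toℕ (lookup u i) ∎)
    blocks≡ : map (blockFin s) f ≡ e
    blocks≡ = lookup-ext λ i → toℕ-injective (begin
      toℕ (lookup (map (blockFin s) f) i)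
        ≡⟨ lookup-blocks s f i ⟩
      block s (toℕ (lookup f i))
        ≡⟨ cong (block s) (lookup-assemble u e i) ⟩
      block s (position s (toℕ (lookup u i)) (toℕ (lookup e i)))
        ≡⟨ block-position (rotation≤m u) (toℕ<n (lookup u i)) (toℕ<n (lookup e i)) ⟩
      toℕ (lookup e i) ∎)

homTo-cycleAdj-lift : (F : Graph) (m k : ℕ) .{{_ : NonZero m}} .{{_ : NonZero k}} → order F < m →
                      homTo F (cycleAdj (m * k)) ≡ homTo F (cycleAdj m) * homTo F (diagonal k)
homTo-cycleAdj-lift F m k r<m = homTo-factor F (cycleAdj (m * k)) (cycleAdj m) (diagonal k) (record
  { to        = split
  ; from      = assemble
  ; to-resp   = λ {f} → split-resp f
  ; from-resp = λ {(u , e)} → assemble-resp u e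
  ; from∘to   = λ {f} _ → assemble∘split f
  ; to∘from   = λ {(u , e)} _ → split∘assemble u e
  })
  where open Lift F m k r<m

same-answers⇒same-class : {𝒞 : Graph → Set} (A : TwoAdaptiveHomAlgorithm 𝒞) {G H : Graph} →
                          let open TwoAdaptiveHomAlgorithm A in
                          hom F G ≡ hom F H → hom (N (hom F G)) G ≡ hom (N (hom F G)) H → 𝒞 G → 𝒞 H
same-answers⇒same-class A {G} {H} F-same N-same G∈𝒞 =
  proj₂ (correct H) (subst X (cong₂ _,_ F-same (trans N-same (cong (λ n → hom (N n) H) F-same)))
                               (proj₁ (correct G) G∈𝒞))
  where open TwoAdaptiveHomAlgorithm A

module FoolingGraphs (F : Graph) where

  q : ℕ
  q = 3 + order F * 2

  q-odd : q % 2 ≡ 1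
  q-odd = [m+kn]%n≡m%n 3 (order F) 2

  q²-odd : q * q % 2 ≡ 1
  q²-odd = trans (%-distribˡ-* q q 2) (cong₂ (λ a b → a * b % 2) q-odd q-odd)

  F<q : order F < q
  F<q = s≤s (≤-trans (m≤m*n (order F) 2) (≤-trans (n≤1+n _) (n≤1+n _)))

  cycle : Graph
  cycle = cycleGraph (q * q * 2) (s≤s (s≤s z≤n))

  cycle-isCycle : IsCycle cycle
  cycle-isCycle = cycleGraph-isCycle (s≤s (s≤s z≤n)) (s≤s (s≤s (s≤s z≤n)))

  twoCycles : Graph
  twoCycles = disjointCycles 2 (q * q) (s≤s (s≤s z≤n))

  manyCycles : Graph
  manyCycles = disjointCycles q (q * 2) (s≤s (s≤s z≤n))

  twoCycles-F : hom F twoCycles ≡ hom F cycle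
  twoCycles-F = begin
    homTo F (diagonal 2 ⊗ cycleAdj (q * q))
      ≡⟨ homTo-⊗ F (diagonal 2) (cycleAdj (q * q)) ⟩
    homTo F (diagonal 2) * homTo F (cycleAdj (q * q))
      ≡⟨ *-comm (homTo F (diagonal 2)) _ ⟩
    homTo F (cycleAdj (q * q)) * homTo F (diagonal 2)
      ≡⟨ homTo-cycleAdj-lift F (q * q) 2 (≤-trans F<q (m≤m*n q q)) ⟨
    homTo F (cycleAdj (q * q * 2)) ∎
    where open ≡-Reasoning

  manyCycles-F : hom F manyCycles ≡ hom F cycle
  manyCycles-F = begin
    homTo F (diagonal q ⊗ cycleAdj (q * 2))
      ≡⟨ homTo-⊗ F (diagonal q) (cycleAdj (q * 2)) ⟩
    homTo F (diagonal q) * homTo F (cycleAdj (q * 2))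
      ≡⟨ *-comm (homTo F (diagonal q)) _ ⟩
    homTo F (cycleAdj (q * 2)) * homTo F (diagonal q)
      ≡⟨ homTo-cycleAdj-lift F (q * 2) q (≤-trans F<q (m≤m*n q 2)) ⟨
    homTo F (cycleAdj (q * 2 * q))
      ≡⟨ cong (λ n → homTo F (cycleAdj n)) q*2*q≡q*q*2 ⟩
    homTo F (cycleAdj (q * q * 2)) ∎
    where
    open ≡-Reasoning
    q*2*q≡q*q*2 : q * 2 * q ≡ q * q * 2
    q*2*q≡q*q*2 = trans (*-assoc q 2 q) (trans (cong (q *_) (*-comm 2 q)) (sym (*-assoc q q 2)))

  twoCycles-bipartite : (Q : Graph) (c : Vec (Fin 2) (order Q)) → IsHomTo Q (cycleAdj 2) c →
                        hom Q twoCycles ≡ hom Q cycle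
  twoCycles-bipartite Q c c-hom = begin
    homTo Q (diagonal 2 ⊗ cycleAdj (q * q))
      ≡⟨ homTo-⊗ Q (diagonal 2) (cycleAdj (q * q)) ⟩
    homTo Q (diagonal 2) * homTo Q (cycleAdj (q * q))
      ≡⟨ *-comm (homTo Q (diagonal 2)) _ ⟩
    homTo Q (cycleAdj (q * q)) * homTo Q (diagonal 2)
      ≡⟨ cong (homTo Q (cycleAdj (q * q)) *_) (homTo-cycleAdj-2-bipartite Q c c-hom) ⟨
    homTo Q (cycleAdj (q * q)) * homTo Q (cycleAdj 2)
      ≡⟨ homTo-cycleAdj-double Q (q * q) q²-odd ⟨
    homTo Q (cycleAdj (q * q * 2)) ∎
    where open ≡-Reasoning

  manyCycles-non-bipartite : (Q : Graph) → homTo Q (cycleAdj 2) ≡ 0 → hom Q manyCycles ≡ hom Q cycle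
  manyCycles-non-bipartite Q no-2-colouring = begin
    homTo Q (diagonal q ⊗ cycleAdj (q * 2))
      ≡⟨ homTo-⊗ Q (diagonal q) (cycleAdj (q * 2)) ⟩
    homTo Q (diagonal q) * homTo Q (cycleAdj (q * 2))
      ≡⟨ cong (homTo Q (diagonal q) *_) (homTo-cycleAdj-double≡0 Q q q-odd no-2-colouring) ⟩
    homTo Q (diagonal q) * 0
      ≡⟨ *-zeroʳ (homTo Q (diagonal q)) ⟩
    0
      ≡⟨ homTo-cycleAdj-double≡0 Q (q * q) q²-odd no-2-colouring ⟨
    homTo Q (cycleAdj (q * q * 2)) ∎
    where open ≡-Reasoning

  impostor : (Q : Graph) → Σ Graph λ H → ¬ IsCycle H × hom F H ≡ hom F cycle × hom Q H ≡ hom Q cycle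
  impostor Q with homTo Q (cycleAdj 2) ℕ.≟ 0
  ... | yes no-2-colouring =
    manyCycles , disjointCycles-¬IsCycle q (q * 2) (s≤s (s≤s z≤n)) (s≤s (s≤s z≤n)) ,
    manyCycles-F , manyCycles-non-bipartite Q no-2-colouring
  ... | no 2-colourable with c , c-hom ← count≢0⇒∃ (isHomTo Q (cycleAdj 2)) (allMaps (order Q) 2) 2-colourable =
    twoCycles , disjointCycles-¬IsCycle 2 (q * q) (s≤s (s≤s z≤n)) (s≤s (s≤s z≤n)) ,
    twoCycles-F , twoCycles-bipartite Q c (Equivalence.to (T-isHomTo Q (cycleAdj 2) c) c-hom)

theorem8p9 : ¬ TwoAdaptiveHomAlgorithm IsCycle
theorem8p9 A =
  let H , H-¬cycle , F-same , Q-same = impostor (N (hom F cycle))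
  in H-¬cycle (same-answers⇒same-class A {cycle} {H} (sym F-same) (sym Q-same) cycle-isCycle)
  where
  open TwoAdaptiveHomAlgorithm A
  open FoolingGraphs F
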